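{- For all $u,v\in F_2$, $\mathrm{Pal}(uv)=L_u(\mathrm{Pal}(v))\,\mathrm{Pal}(u)$.
   Context: $F_2$ is the free group on $a,b$. $w\mapsto R_w$ is the group homomorphism $F_2\to\mathrm{Aut}(F_2)$ with $R_a(a)=a$, $R_a(b)=ba$, $R_b(a)=ab$, $R_b(b)=b$. The palindromization map $\mathrm{Pal}:F_2\to F_2$ is defined by $\mathrm{Pal}(w)=b^{ -1}a^{ -1}R_w(ab)$. $w\mapsto L_w$ is the group homomorphism $F_2\to\mathrm{Aut}(F_2)$ with $L_a(a)=a$, $L_a(b)=ab$, $L_b(a)=ba$, $L_b(b)=b$. -}

module Defs where

open import Data.Bool using (Bool; true; false; not; _xor_)
open import Data.List using (List; []; _∷_; _++_; reverse; map; concatMap)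
open import Data.Product using (_×_; _,_)
open import Function using (id; _∘_)
open import Relation.Binary.PropositionalEquality using (_≡_)

data Letter : Set where
  a b : Letter

-- A symbol: a generator with a flag; (x , false) is x, (x , true) is x⁻¹.
Sym : Set
Sym = Letter × Bool

-- Words over {a, b, a⁻¹, b⁻¹}.  Elements of F₂ are represented by words;
-- two words represent the same element iff their free reductions agree.
Word : Set
Word = List Sym

sinv : Sym → Sym
sinv (x , e) = (x , not e)

winv : Word → Word
winv w = reverse (map sinv w)

ga gb : Word
ga = (a , false) ∷ []
gb = (b , false) ∷ []

cancels : Sym → Sym → Bool
cancels (a , e) (a , f) = e xor f
cancels (b , e) (b , f) = e xor f
cancels _ _ = false

push : Sym → Word → Word
push s [] = s ∷ []
push s (t ∷ w) with cancels s t
... | true  = w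
... | false = s ∷ t ∷ w

reduce : Word → Word
reduce [] = []
reduce (s ∷ w) = push s (reduce w)

infix 4 _≈F_
_≈F_ : Word → Word → Set
u ≈F v = reduce u ≡ reduce v

subst : Word → Word → Word → Word
subst p q = concatMap img
  where
  img : Sym → Word
  img (a , false) = p
  img (a , true)  = winv p
  img (b , false) = q
  img (b , true)  = winv q

-- The automorphism R_s for a symbol s (and R_{s⁻¹} = (R_s)⁻¹):
-- R_a : a ↦ a, b ↦ ba;   R_a⁻¹ : a ↦ a, b ↦ ba⁻¹;
-- R_b : a ↦ ab, b ↦ b;   R_b⁻¹ : a ↦ ab⁻¹, b ↦ b.
Rsym : Sym → Word → Word
Rsym (a , false) = subst ga (gb ++ ga)
Rsym (a , true)  = subst ga (gb ++ winv ga)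
Rsym (b , false) = subst (ga ++ gb) gb
Rsym (b , true)  = subst (ga ++ winv gb) gb

Lsym : Sym → Word → Word
Lsym (a , false) = subst ga (ga ++ gb)
Lsym (a , true)  = subst ga (winv ga ++ gb)
Lsym (b , false) = subst (gb ++ ga) gb
Lsym (b , true)  = subst (winv gb ++ ga) gb

R : Word → Word → Word
R []      = id
R (s ∷ w) = Rsym s ∘ R w

L : Word → Word → Word
L []      = id
L (s ∷ w) = Lsym s ∘ L w

Pal : Word → Word
Pal w = winv gb ++ winv ga ++ R w (ga ++ gb)

module Submission where

-- The heart of the proof is
-- a conjugation identity between the two actions of a symbol s:
--     R_s(x) = s⁻¹ · L_s(x) · s.
-- Since Pal(w) = b⁻¹a⁻¹ R_w(ab), we have R_w(ab) = ab · Pal(w); applying R_s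
-- and the conjugation identity gives the one-symbol recursion
--     Pal(s w) = L_s(Pal w) · s,
-- from which the proposition follows by induction on u, using that
-- L_{su} = L_s ∘ L_u and that L_s is an endomorphism of F₂.

open import Defs
open import Data.Bool using (false; true)
open import Data.List using ([]; _∷_; _++_; foldr; reverse; map)
open import Data.List.Properties using (++-assoc; ++-identityʳ; reverse-++; reverse-map; reverse-involutive; map-∘; map-cong; map-id)
open import Data.Product using (_,_)
open import Relation.Binary.Bundles using (Setoid)
open import Relation.Binary.PropositionalEquality as ≡ using (_≡_; refl; cong)
import Relation.Binary.Reasoning.Setoid as SetoidReasoning

sinv-involutive : ∀ s → sinv (sinv s) ≡ s
sinv-involutive (x , false) = refl
sinv-involutive (x , true)  = refl

cancels-sinv : ∀ s → cancels s (sinv s) ≡ true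
cancels-sinv (a , false) = refl
cancels-sinv (a , true)  = refl
cancels-sinv (b , false) = refl
cancels-sinv (b , true)  = refl

cancels⇒sinv : ∀ s t → cancels s t ≡ true → t ≡ sinv s
cancels⇒sinv (a , false) (a , true)  _ = refl
cancels⇒sinv (a , true)  (a , false) _ = refl
cancels⇒sinv (b , false) (b , true)  _ = refl
cancels⇒sinv (b , true)  (b , false) _ = refl
cancels⇒sinv (a , false) (a , false) ()
cancels⇒sinv (a , true)  (a , true)  ()
cancels⇒sinv (b , false) (b , false) ()
cancels⇒sinv (b , true)  (b , true)  ()
cancels⇒sinv (a , _)     (b , _)     ()
cancels⇒sinv (b , _)     (a , _)     ()

data Reduced : Word → Set where
  nil  : Reduced []
  one  : ∀ s → Reduced (s ∷ [])
  cons : ∀ {s t w} → cancels s t ≡ false → Reduced (t ∷ w) → Reduced (s ∷ t ∷ w)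

Reduced-tail : ∀ {s w} → Reduced (s ∷ w) → Reduced w
Reduced-tail (one s)    = nil
Reduced-tail (cons _ r) = r

push-cancelling : ∀ {s t} w → cancels s t ≡ true → push s (t ∷ w) ≡ w
push-cancelling {s} {t} w c with cancels s t
push-cancelling w refl | true = refl

push-noncancelling : ∀ {s t} w → cancels s t ≡ false → push s (t ∷ w) ≡ s ∷ t ∷ w
push-noncancelling {s} {t} w c with cancels s t
push-noncancelling w refl | false = refl

push-head : ∀ {s w} → Reduced (s ∷ w) → push s w ≡ s ∷ w
push-head (one s)    = refl
push-head (cons c _) = push-noncancelling _ c

push-reduced : ∀ s {w} → Reduced w → Reduced (push s w)
push-reduced s nil = one s
push-reduced s {t ∷ w} r with cancels s t in c
... | true  = Reduced-tail r
... | false = cons c r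

reduce-reduced : ∀ w → Reduced (reduce w)
reduce-reduced []      = nil
reduce-reduced (s ∷ w) = push-reduced s (reduce-reduced w)

push-inverse : ∀ s {w} → Reduced w → push s (push (sinv s) w) ≡ w
push-inverse s nil = push-cancelling [] (cancels-sinv s)
push-inverse s {t ∷ w} r with cancels (sinv s) t in c
... | false = push-cancelling (t ∷ w) (cancels-sinv s)
... | true  = ≡.trans (cong (λ u → push u w) s≡t) (push-head r)
  where
  s≡t : s ≡ t
  s≡t = ≡.sym (≡.trans (cancels⇒sinv (sinv s) t c) (sinv-involutive s))

pushAll : Word → Word → Word
pushAll x w = foldr push w x

pushAll-reduced : ∀ x {w} → Reduced w → Reduced (pushAll x w)
pushAll-reduced []      r = r
pushAll-reduced (s ∷ x) r = push-reduced s (pushAll-reduced x r)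

reduce-++ : ∀ x y → reduce (x ++ y) ≡ pushAll x (reduce y)
reduce-++ []      y = refl
reduce-++ (s ∷ x) y = cong (push s) (reduce-++ x y)

push-pushAll : ∀ s x {w} → Reduced w → push s (pushAll x w) ≡ pushAll (push s x) w
push-pushAll s []      r = refl
push-pushAll s (t ∷ x) r with cancels s t in c
... | false = refl
... | true rewrite cancels⇒sinv s t c = push-inverse s (pushAll-reduced x r)

pushAll-reduce : ∀ x {w} → Reduced w → pushAll x w ≡ pushAll (reduce x) w
pushAll-reduce []      r = refl
pushAll-reduce (s ∷ x) r = ≡.trans (cong (push s) (pushAll-reduce x r)) (push-pushAll s (reduce x) r)

-- Equality in F₂, wrapped in a record so that the two words can be inferred
-- from a proof (they cannot be recovered from  reduce x ≡ reduce y).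
infix 4 _≃_
record _≃_ (x y : Word) : Set where
  constructor same-reduct
  field reduct-eq : x ≈F y
open _≃_

F₂ : Setoid _ _
F₂ = record
  { Carrier       = Word
  ; _≈_           = _≃_
  ; isEquivalence = record
    { refl  = same-reduct refl
    ; sym   = λ p → same-reduct (≡.sym (reduct-eq p))
    ; trans = λ p q → same-reduct (≡.trans (reduct-eq p) (reduct-eq q))
    }
  }

open Setoid F₂ using () renaming (sym to ≃-sym)
module ≃-Reasoning = SetoidReasoning F₂

++-congˡ : ∀ {x x'} y → x ≃ x' → x ++ y ≃ x' ++ y
++-congˡ {x} {x'} y (same-reduct x≈x') = same-reduct (begin
  reduce (x ++ y)                ≡⟨ reduce-++ x y ⟩
  pushAll x (reduce y)           ≡⟨ pushAll-reduce x (reduce-reduced y) ⟩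
  pushAll (reduce x) (reduce y)  ≡⟨ cong (λ z → pushAll z (reduce y)) x≈x' ⟩
  pushAll (reduce x') (reduce y) ≡⟨ pushAll-reduce x' (reduce-reduced y) ⟨
  pushAll x' (reduce y)          ≡⟨ reduce-++ x' y ⟨
  reduce (x' ++ y)               ∎)
  where open ≡.≡-Reasoning

++-congʳ : ∀ x {y y'} → y ≃ y' → x ++ y ≃ x ++ y'
++-congʳ x {y} {y'} (same-reduct y≈y') =
  same-reduct (≡.trans (reduce-++ x y) (≡.trans (cong (pushAll x) y≈y') (≡.sym (reduce-++ x y'))))

cancel-pair : ∀ s y → s ∷ sinv s ∷ y ≃ y
cancel-pair s y = same-reduct (push-inverse s (reduce-reduced y))

cancel-pair⁻ : ∀ s y → sinv s ∷ s ∷ y ≃ y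
cancel-pair⁻ s y = begin
  sinv s ∷ s ∷ y               ≡⟨ cong (λ t → sinv s ∷ t ∷ y) (sinv-involutive s) ⟨
  sinv s ∷ sinv (sinv s) ∷ y   ≈⟨ cancel-pair (sinv s) y ⟩
  y                            ∎
  where open ≃-Reasoning

winv-∷ : ∀ s x → winv (s ∷ x) ≡ winv x ++ sinv s ∷ []
winv-∷ s x = reverse-++ (sinv s ∷ []) (map sinv x)

winv-cancel : ∀ x y → x ++ winv x ++ y ≃ y
winv-cancel []      y = same-reduct refl
winv-cancel (s ∷ x) y = begin
  s ∷ x ++ winv (s ∷ x) ++ y         ≡⟨ cong (λ z → s ∷ x ++ z ++ y) (winv-∷ s x) ⟩
  s ∷ x ++ (winv x ++ sinv s ∷ []) ++ y ≡⟨ cong (λ z → s ∷ x ++ z) (++-assoc (winv x) (sinv s ∷ []) y) ⟩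
  s ∷ x ++ winv x ++ sinv s ∷ y      ≈⟨ ++-congʳ (s ∷ []) (winv-cancel x (sinv s ∷ y)) ⟩
  s ∷ sinv s ∷ y                     ≈⟨ cancel-pair s y ⟩
  y                                  ∎
  where open ≃-Reasoning

winv-involutive : ∀ x → winv (winv x) ≡ x
winv-involutive x = begin
  reverse (map sinv (reverse (map sinv x))) ≡⟨ cong reverse (reverse-map sinv (map sinv x)) ⟩
  reverse (reverse (map sinv (map sinv x))) ≡⟨ reverse-involutive (map sinv (map sinv x)) ⟩
  map sinv (map sinv x)                     ≡⟨ map-∘ x ⟨
  map (λ s → sinv (sinv s)) x               ≡⟨ map-cong sinv-involutive x ⟩
  map (λ s → s) x                           ≡⟨ map-id x ⟩
  x                                         ∎
  where open ≡.≡-Reasoning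

winv-cancel⁻ : ∀ x y → winv x ++ x ++ y ≃ y
winv-cancel⁻ x y = begin
  winv x ++ x ++ y               ≡⟨ cong (λ z → winv x ++ z ++ y) (winv-involutive x) ⟨
  winv x ++ winv (winv x) ++ y   ≈⟨ winv-cancel (winv x) y ⟩
  y                              ∎
  where open ≃-Reasoning

img : Word → Word → Sym → Word
img p q (a , false) = p
img p q (a , true)  = winv p
img p q (b , false) = q
img p q (b , true)  = winv q

subst-∷ : ∀ p q s x → subst p q (s ∷ x) ≡ img p q s ++ subst p q x
subst-∷ p q (a , false) x = refl
subst-∷ p q (a , true)  x = refl
subst-∷ p q (b , false) x = refl
subst-∷ p q (b , true)  x = refl

subst-++ : ∀ p q x y → subst p q (x ++ y) ≡ subst p q x ++ subst p q y
subst-++ p q []      y = refl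
subst-++ p q (s ∷ x) y = begin
  subst p q (s ∷ x ++ y)                       ≡⟨ subst-∷ p q s (x ++ y) ⟩
  img p q s ++ subst p q (x ++ y)              ≡⟨ cong (img p q s ++_) (subst-++ p q x y) ⟩
  img p q s ++ subst p q x ++ subst p q y      ≡⟨ ++-assoc (img p q s) _ _ ⟨
  (img p q s ++ subst p q x) ++ subst p q y    ≡⟨ cong (_++ subst p q y) (subst-∷ p q s x) ⟨
  subst p q (s ∷ x) ++ subst p q y             ∎
  where open ≡.≡-Reasoning

img-inverse : ∀ p q s y → img p q s ++ img p q (sinv s) ++ y ≃ y
img-inverse p q (a , false) y = winv-cancel p y
img-inverse p q (a , true)  y = winv-cancel⁻ p y
img-inverse p q (b , false) y = winv-cancel q y
img-inverse p q (b , true)  y = winv-cancel⁻ q y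

subst-push : ∀ p q s x → subst p q (push s x) ≃ img p q s ++ subst p q x
subst-push p q s [] = same-reduct (cong reduce (subst-∷ p q s []))
subst-push p q s (t ∷ x) with cancels s t in c
... | false = same-reduct (cong reduce (subst-∷ p q s (t ∷ x)))
... | true rewrite cancels⇒sinv s t c = begin
  subst p q x                                       ≈⟨ img-inverse p q s (subst p q x) ⟨
  img p q s ++ img p q (sinv s) ++ subst p q x      ≡⟨ cong (img p q s ++_) (subst-∷ p q (sinv s) x) ⟨
  img p q s ++ subst p q (sinv s ∷ x)               ∎
  where open ≃-Reasoning

subst-reduce : ∀ p q x → subst p q x ≃ subst p q (reduce x)
subst-reduce p q []      = same-reduct refl
subst-reduce p q (s ∷ x) = begin
  subst p q (s ∷ x)                      ≡⟨ subst-∷ p q s x ⟩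
  img p q s ++ subst p q x               ≈⟨ ++-congʳ (img p q s) (subst-reduce p q x) ⟩
  img p q s ++ subst p q (reduce x)      ≈⟨ subst-push p q s (reduce x) ⟨
  subst p q (push s (reduce x))          ∎
  where open ≃-Reasoning

record Endomorphism (f : Word → Word) : Set where
  field
    ε-hom  : f [] ≡ []
    ++-hom : ∀ x y → f (x ++ y) ≡ f x ++ f y
    resp   : ∀ {x y} → x ≃ y → f x ≃ f y
open Endomorphism

subst-endomorphism : ∀ p q → Endomorphism (subst p q)
subst-endomorphism p q = record
  { ε-hom  = refl
  ; ++-hom = subst-++ p q
  ; resp   = λ {x} {y} x≃y → begin
      subst p q x                ≈⟨ subst-reduce p q x ⟩
      subst p q (reduce x)       ≡⟨ cong (subst p q) (reduct-eq x≃y) ⟩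
      subst p q (reduce y)       ≈⟨ subst-reduce p q y ⟨
      subst p q y                ∎
  }
  where open ≃-Reasoning

Lsym-endomorphism : ∀ s → Endomorphism (Lsym s)
Lsym-endomorphism (a , false) = subst-endomorphism _ _
Lsym-endomorphism (a , true)  = subst-endomorphism _ _
Lsym-endomorphism (b , false) = subst-endomorphism _ _
Lsym-endomorphism (b , true)  = subst-endomorphism _ _

Rsym-endomorphism : ∀ s → Endomorphism (Rsym s)
Rsym-endomorphism (a , false) = subst-endomorphism _ _
Rsym-endomorphism (a , true)  = subst-endomorphism _ _
Rsym-endomorphism (b , false) = subst-endomorphism _ _
Rsym-endomorphism (b , true)  = subst-endomorphism _ _

Rsym-conj-symbol : ∀ s t → Rsym s (t ∷ []) ≃ sinv s ∷ Lsym s (t ∷ []) ++ s ∷ []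
Rsym-conj-symbol (a , false) (a , false) = same-reduct refl
Rsym-conj-symbol (a , false) (a , true)  = same-reduct refl
Rsym-conj-symbol (a , false) (b , false) = same-reduct refl
Rsym-conj-symbol (a , false) (b , true)  = same-reduct refl
Rsym-conj-symbol (a , true)  (a , false) = same-reduct refl
Rsym-conj-symbol (a , true)  (a , true)  = same-reduct refl
Rsym-conj-symbol (a , true)  (b , false) = same-reduct refl
Rsym-conj-symbol (a , true)  (b , true)  = same-reduct refl
Rsym-conj-symbol (b , false) (a , false) = same-reduct refl
Rsym-conj-symbol (b , false) (a , true)  = same-reduct refl
Rsym-conj-symbol (b , false) (b , false) = same-reduct refl
Rsym-conj-symbol (b , false) (b , true)  = same-reduct refl
Rsym-conj-symbol (b , true)  (a , false) = same-reduct refl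
Rsym-conj-symbol (b , true)  (a , true)  = same-reduct refl
Rsym-conj-symbol (b , true)  (b , false) = same-reduct refl
Rsym-conj-symbol (b , true)  (b , true)  = same-reduct refl

-- The conjugation identity R_s(x) = s⁻¹ L_s(x) s, by induction on x: both
-- sides are multiplicative, the inner factors s s⁻¹ cancelling.
Rsym-conj : ∀ s x → Rsym s x ≃ sinv s ∷ Lsym s x ++ s ∷ []
Rsym-conj s [] = begin
  Rsym s []                       ≡⟨ ε-hom (Rsym-endomorphism s) ⟩
  []                              ≈⟨ cancel-pair⁻ s [] ⟨
  sinv s ∷ s ∷ []                 ≡⟨ cong (λ z → sinv s ∷ z ++ s ∷ []) (ε-hom (Lsym-endomorphism s)) ⟨
  sinv s ∷ Lsym s [] ++ s ∷ []    ∎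
  where open ≃-Reasoning
Rsym-conj s (t ∷ x) = begin
  Rsym s (t ∷ x)                             ≡⟨ ++-hom (Rsym-endomorphism s) (t ∷ []) x ⟩
  Rsym s (t ∷ []) ++ Rsym s x                ≈⟨ ++-congˡ (Rsym s x) (Rsym-conj-symbol s t) ⟩
  (s⁻¹ ∷ Lt ++ s ∷ []) ++ Rsym s x           ≈⟨ ++-congʳ (s⁻¹ ∷ Lt ++ s ∷ []) (Rsym-conj s x) ⟩
  (s⁻¹ ∷ Lt ++ s ∷ []) ++ s⁻¹ ∷ Lx ++ s ∷ [] ≡⟨ cong (s⁻¹ ∷_) (++-assoc Lt (s ∷ []) _) ⟩
  s⁻¹ ∷ Lt ++ s ∷ s⁻¹ ∷ Lx ++ s ∷ []         ≈⟨ ++-congʳ (s⁻¹ ∷ Lt) (cancel-pair s (Lx ++ s ∷ [])) ⟩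
  s⁻¹ ∷ Lt ++ Lx ++ s ∷ []                   ≡⟨ cong (s⁻¹ ∷_) (++-assoc Lt Lx (s ∷ [])) ⟨
  s⁻¹ ∷ (Lt ++ Lx) ++ s ∷ []                 ≡⟨ cong (λ z → s⁻¹ ∷ z ++ s ∷ []) (++-hom (Lsym-endomorphism s) (t ∷ []) x) ⟨
  s⁻¹ ∷ Lsym s (t ∷ x) ++ s ∷ []             ∎
  where
  open ≃-Reasoning
  s⁻¹ = sinv s
  Lt  = Lsym s (t ∷ [])
  Lx  = Lsym s x

ab : Word
ab = ga ++ gb

R-ab : ∀ w → R w ab ≃ ab ++ Pal w
R-ab w = ≃-sym (winv-cancel ab (R w ab))

Pal-[] : Pal [] ≃ []
Pal-[] = same-reduct refl

Pal-symbol : ∀ s → Pal (s ∷ []) ≃ s ∷ []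
Pal-symbol (a , false) = same-reduct refl
Pal-symbol (a , true)  = same-reduct refl
Pal-symbol (b , false) = same-reduct refl
Pal-symbol (b , true)  = same-reduct refl

Pal-∷ : ∀ s w → Pal (s ∷ w) ≃ Lsym s (Pal w) ++ s ∷ []
Pal-∷ s w = begin
  B ++ Rsym s (R w ab)                         ≈⟨ ++-congʳ B (resp (Rsym-endomorphism s) (R-ab w)) ⟩
  B ++ Rsym s (ab ++ Pal w)                    ≡⟨ cong (B ++_) (++-hom (Rsym-endomorphism s) ab (Pal w)) ⟩
  B ++ Rsym s ab ++ Rsym s (Pal w)             ≡⟨ ++-assoc B (Rsym s ab) _ ⟨
  Pal (s ∷ []) ++ Rsym s (Pal w)               ≈⟨ ++-congˡ (Rsym s (Pal w)) (Pal-symbol s) ⟩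
  s ∷ Rsym s (Pal w)                           ≈⟨ ++-congʳ (s ∷ []) (Rsym-conj s (Pal w)) ⟩
  s ∷ sinv s ∷ Lsym s (Pal w) ++ s ∷ []        ≈⟨ cancel-pair s _ ⟩
  Lsym s (Pal w) ++ s ∷ []                     ∎
  where
  open ≃-Reasoning
  B = winv gb ++ winv ga

proposition4p3 : (u v : Word) → Pal (u ++ v) ≈F L u (Pal v) ++ Pal u
proposition4p3 u v = reduct-eq (Pal-++ u v)
  where
  open ≃-Reasoning
  Pal-++ : ∀ u v → Pal (u ++ v) ≃ L u (Pal v) ++ Pal u
  Pal-++ [] v = begin
    Pal v            ≡⟨ ++-identityʳ (Pal v) ⟨
    Pal v ++ []      ≈⟨ ++-congʳ (Pal v) Pal-[] ⟨
    Pal v ++ Pal []  ∎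
  Pal-++ (s ∷ u) v = begin
    Pal (s ∷ u ++ v)                                 ≈⟨ Pal-∷ s (u ++ v) ⟩
    Ls (Pal (u ++ v)) ++ s ∷ []                      ≈⟨ ++-congˡ (s ∷ []) (resp (Lsym-endomorphism s) (Pal-++ u v)) ⟩
    Ls (L u (Pal v) ++ Pal u) ++ s ∷ []              ≡⟨ cong (_++ s ∷ []) (++-hom (Lsym-endomorphism s) (L u (Pal v)) (Pal u)) ⟩
    (Ls (L u (Pal v)) ++ Ls (Pal u)) ++ s ∷ []       ≡⟨ ++-assoc (Ls (L u (Pal v))) (Ls (Pal u)) (s ∷ []) ⟩
    Ls (L u (Pal v)) ++ Ls (Pal u) ++ s ∷ []         ≈⟨ ++-congʳ (Ls (L u (Pal v))) (Pal-∷ s u) ⟨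
    L (s ∷ u) (Pal v) ++ Pal (s ∷ u)                 ∎
    where Ls = Lsym s
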